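{- Let $p_1=2<p_2=3<p_3=5<\cdots$ be the primes in increasing order. For $i\ge 1$ let $D_i=(d^{(i)}_n)_{n\ge 0}$ be the infinite sequence over the alphabet $\{R,L\}$ defined by $d^{(i)}_n=L$ if $n$ is divisible by none of $p_1,\dots,p_i$, and $d^{(i)}_n=R$ otherwise (so $d^{(i)}_0=R$). Let $D_\infty=(d^{(\infty)}_n)_{n\ge0}$ be the sequence $RLRRR\cdots=RLR^\infty$, i.e. $d^{(\infty)}_1=L$ and $d^{(\infty)}_n=R$ for all $n\neq 1$. Then, with respect to the order on symbol sequences described in the context, $$D_1<D_2<D_3<\cdots<D_i<D_{i+1}<\cdots<D_\infty .$$
   Context: Symbol sequences: $D_i$ is the $\bullet$-composition $M_{p_1}\bullet\cdots\bullet M_{p_i}$ of the periodic sequences $M_p=(RL^{p-1})^\infty$ (position $n\ge0$ of $M_p$ is $R$ iff $p\mid n$), where the composition of two sequences is taken position-wise with $L\bullet L=L$ and $a\bullet b=R$ otherwise; this is equivalent to the explicit description in the claim. Order (the standard ordering of symbolic dynamics for unimodal maps): on single symbols $L<C<R$. Two distinct sequences $A=a_0a_1\dots$ and $B=b_0b_1\dots$ are compared at the first index $k$ where $a_k\neq b_k$: let $m$ be the number of occurrences of $R$ in the common prefix $a_0\cdots a_{k-1}$. If $m$ is even (the prefix is an "even sequence"), then $A<B$ iff $a_k<b_k$; if $m$ is odd, then $A<B$ iff $a_k>b_k$. -}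

module Defs where

open import Data.Nat using (ℕ; zero; suc; _+_; _<_; _≤_)
open import Data.Nat.Divisibility using (_∣_; _∣?_)
open import Data.Nat.Primality using (Prime)
open import Data.Product using (Σ; ∃; _×_; _,_)
open import Data.Sum using (_⊎_)
open import Relation.Nullary using (¬_; yes; no)
open import Relation.Binary.PropositionalEquality using (_≡_; _≢_)
open import Data.Empty using (⊥)
open import Data.Unit using (⊤)

data Sym : Set where
  L C R : Sym

_<ₛ_ : Sym → Sym → Set
L <ₛ C = ⊤
L <ₛ R = ⊤
C <ₛ R = ⊤
_ <ₛ _ = ⊥

Seq : Set
Seq = ℕ → Sym

isR : Sym → ℕ
isR R = 1
isR _ = 0

countR : Seq → ℕ → ℕ
countR A zero = 0
countR A (suc k) = countR A k + isR (A k)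

data Even : ℕ → Set where
  even0 : Even 0
  evenSS : ∀ {n} → Even n → Even (suc (suc n))

Odd : ℕ → Set
Odd n = Even (suc n)

_≺_ : Seq → Seq → Set
A ≺ B = Σ ℕ λ k →
  (∀ j → j < k → A j ≡ B j) × (A k ≢ B k) ×
  ((Even (countR A k) × (A k <ₛ B k)) ⊎ (Odd (countR A k) × (B k <ₛ A k)))

-- the primes in increasing order: p 0 = p₁ = 2, p 1 = p₂ = 3, ...
IsPrimeEnumeration : (ℕ → ℕ) → Set
IsPrimeEnumeration p =
  (∀ j → Prime (p j)) × (∀ j → p j < p (suc j)) × (∀ q → Prime q → ∃ λ j → p j ≡ q)

-- is n divisible by one of p 0, ..., p (i-1)  (i.e. p₁,...,pᵢ)?
divBy : (ℕ → ℕ) → ℕ → ℕ → Sym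
divBy p zero n = L
divBy p (suc i) n with p i ∣? n
... | yes _ = R
... | no _ = divBy p i n

D : (ℕ → ℕ) → ℕ → Seq
D p i n = divBy p i n

D∞ : Seq
D∞ 1 = L
D∞ _ = R

{-# OPTIONS --safe #-}
module Submission where

-- For i ≥ 1 the sequences Dᵢ, Dᵢ₊₁ and D∞ agree below pᵢ: position 0 is R, position 1 is L,
-- and every 2 ≤ n < pᵢ has a prime factor smaller than pᵢ, hence among p₁, …, pᵢ₋₁.
-- At position pᵢ the sequence Dᵢ has L while Dᵢ₊₁ and D∞ have R. The common prefix
-- RLR⋯R of length pᵢ contains pᵢ − 1 letters R, an even number because pᵢ is an odd
-- prime, so this first difference puts Dᵢ below both.

open import Defs
open import Data.Nat using (ℕ; zero; suc; _≤_; _<_; z≤n; s≤s; _+_; nonTrivial⇒n>1)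
open import Data.Nat.Properties
open import Data.Nat.Divisibility using (_∣_; _∣?_; divides; _∣0; ∣-refl; ∣1⇒≡1; ∣⇒≤)
open import Data.Nat.Primality using (Prime; prime[2]; prime⇒irreducible; prime⇒nonTrivial; ¬prime[1])
open import Data.Nat.Primality.Factorisation using (factorise)
open import Data.Nat.ListAction using (product)
open import Data.List using ([]; _∷_)
open import Data.List.Relation.Unary.All using (_∷_)
open import Data.Product using (∃; _×_; _,_; proj₁; proj₂)
open import Data.Sum using (_⊎_; inj₁; inj₂)
open import Data.Unit using (tt)
open import Relation.Nullary using (¬_; yes; no; contradiction)
open import Relation.Binary.PropositionalEquality

≺-at : ∀ {A B} k → (∀ j → j < k → A j ≡ B j) → A k ≡ L → B k ≡ R → Even (countR A k) → A ≺ B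
≺-at {A} {B} k agree Ak≡L Bk≡R even = k , agree , Ak≢Bk , inj₁ (even , subst₂ _<ₛ_ (sym Ak≡L) (sym Bk≡R) tt)
  where
  Ak≢Bk : A k ≢ B k
  Ak≢Bk eq with () ← trans (sym Ak≡L) (trans eq Bk≡R)

countR-cong : ∀ {A B} k → (∀ j → j < k → A j ≡ B j) → countR A k ≡ countR B k
countR-cong zero agree = refl
countR-cong (suc k) agree =
  cong₂ _+_ (countR-cong k (λ j j<k → agree j (m≤n⇒m≤1+n j<k))) (cong isR (agree k ≤-refl))

countR-D∞ : ∀ m → countR D∞ (2 + m) ≡ 1 + m
countR-D∞ zero = refl
countR-D∞ (suc m) = trans (cong (_+ 1) (countR-D∞ m)) (+-comm (1 + m) 1)

D∞-beyond-1 : ∀ {n} → 1 < n → D∞ n ≡ R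
D∞-beyond-1 {suc (suc _)} _ = refl
D∞-beyond-1 {suc zero} (s≤s ())

even⊎odd : ∀ n → Even n ⊎ Odd n
even⊎odd zero = inj₁ even0
even⊎odd (suc n) with even⊎odd n
... | inj₁ e = inj₂ (evenSS e)
... | inj₂ o = inj₁ o

even⇒2∣ : ∀ {n} → Even n → 2 ∣ n
even⇒2∣ even0 = 2 ∣0
even⇒2∣ (evenSS e) with divides q eq ← even⇒2∣ e = divides (suc q) (cong (2 +_) eq)

prime⇒>1 : ∀ {q} → Prime q → 1 < q
prime⇒>1 {q} pr = nonTrivial⇒n>1 q {{prime⇒nonTrivial pr}}

prime∤1 : ∀ {q} → Prime q → ¬ q ∣ 1
prime∤1 pr q∣1 = ¬prime[1] (subst Prime (∣1⇒≡1 q∣1) pr)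

prime∣prime⇒≡ : ∀ {q r} → Prime q → Prime r → q ∣ r → q ≡ r
prime∣prime⇒≡ q-prime r-prime q∣r with prime⇒irreducible r-prime q∣r
... | inj₁ q≡1 = contradiction (subst Prime q≡1 q-prime) ¬prime[1]
... | inj₂ q≡r = q≡r

odd-prime⇒even-pred : ∀ {n} → Prime (suc n) → 2 < suc n → Even n
odd-prime⇒even-pred {n} pr 2<q with even⊎odd n
... | inj₁ e = e
... | inj₂ o = contradiction (prime∣prime⇒≡ prime[2] pr (even⇒2∣ o)) (<⇒≢ 2<q)

∃-prime-divisor : ∀ n → 1 < n → ∃ λ r → Prime r × r ∣ n
∃-prime-divisor n@(suc (suc _)) _ with factorise n
... | record { factors = [] ; isFactorisation = () }
... | record { factors = r ∷ rs ; isFactorisation = n≡r*Π ; factorsPrime = r-prime ∷ _ } =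
  r , r-prime , divides (product rs) (trans n≡r*Π (*-comm r (product rs)))
∃-prime-divisor (suc zero) (s≤s ())

countR-even-at-odd-prime : ∀ {A q} → Prime q → 2 < q → (∀ j → j < q → A j ≡ D∞ j) → Even (countR A q)
countR-even-at-odd-prime {A} {suc (suc m)} pr 2<q agree =
  subst Even (sym (trans (countR-cong (2 + m) agree) (countR-D∞ m))) (odd-prime⇒even-pred pr 2<q)

divBy-R : ∀ p i n j → j < i → p j ∣ n → divBy p i n ≡ R
divBy-R p (suc i) n j j<1+i pj∣n with p i ∣? n
... | yes _ = refl
... | no pi∤n with m<1+n⇒m<n∨m≡n j<1+i
...   | inj₁ j<i = divBy-R p i n j j<i pj∣n
...   | inj₂ refl = contradiction pj∣n pi∤n

divBy-L : ∀ p i n → (∀ j → j < i → ¬ p j ∣ n) → divBy p i n ≡ L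
divBy-L p zero n _ = refl
divBy-L p (suc i) n none with p i ∣? n
... | yes pi∣n = contradiction pi∣n (none i ≤-refl)
... | no _ = divBy-L p i n (λ j j<i → none j (m≤n⇒m≤1+n j<i))

module PrimeEnumeration {p : ℕ → ℕ} (pe : IsPrimeEnumeration p) where

  p-prime : ∀ j → Prime (p j)
  p-prime = proj₁ pe

  p-step : ∀ j → p j < p (suc j)
  p-step = proj₁ (proj₂ pe)

  p-onto : ∀ q → Prime q → ∃ λ j → p j ≡ q
  p-onto = proj₂ (proj₂ pe)

  p-<-mono : ∀ {j i} → j < i → p j < p i
  p-<-mono {j} {suc i} (s≤s j≤i) with m≤n⇒m<n∨m≡n j≤i
  ... | inj₁ j<i = <-trans (p-<-mono j<i) (p-step i)
  ... | inj₂ refl = p-step i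

  p-≤-mono : ∀ {i j} → i ≤ j → p i ≤ p j
  p-≤-mono i≤j with m≤n⇒m<n∨m≡n i≤j
  ... | inj₁ i<j = <⇒≤ (p-<-mono i<j)
  ... | inj₂ refl = ≤-refl

  p-<-cancel : ∀ {j i} → p j < p i → j < i
  p-<-cancel {j} {i} pj<pi with j <? i
  ... | yes j<i = j<i
  ... | no j≮i = contradiction (p-≤-mono (≮⇒≥ j≮i)) (<⇒≱ pj<pi)

  p>2 : ∀ {i} → 1 ≤ i → 2 < p i
  p>2 1≤i = ≤-<-trans (prime⇒>1 (p-prime 0)) (p-<-mono 1≤i)

  D-below-p : ∀ {i} → 1 ≤ i → ∀ n → n < p i → D p i n ≡ D∞ n
  D-below-p {i} 1≤i zero _ = divBy-R p i 0 0 1≤i (p 0 ∣0)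
  D-below-p {i} _ (suc zero) _ = divBy-L p i 1 (λ j _ → prime∤1 (p-prime j))
  D-below-p {i} 1≤i n@(suc (suc _)) n<pi with ∃-prime-divisor n (s≤s (s≤s z≤n))
  ... | r , r-prime , r∣n with p-onto r r-prime
  ...   | j , refl = divBy-R p i n j (p-<-cancel (≤-<-trans (∣⇒≤ r∣n) n<pi)) r∣n

  D-at-p : ∀ i → D p i (p i) ≡ L
  D-at-p i = divBy-L p i (p i) λ j j<i pj∣pi →
    <⇒≢ (p-<-mono j<i) (prime∣prime⇒≡ (p-prime j) (p-prime i) pj∣pi)

theorem4 : (p : ℕ → ℕ) → IsPrimeEnumeration p →
    (∀ i → 1 ≤ i → D p i ≺ D p (suc i)) × (∀ i → 1 ≤ i → D p i ≺ D∞)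
theorem4 p pe = D-≺-D-suc , D-≺-D∞
  where
  open PrimeEnumeration pe

  even-below-p : ∀ {i} → 1 ≤ i → Even (countR (D p i) (p i))
  even-below-p 1≤i = countR-even-at-odd-prime (p-prime _) (p>2 1≤i) (D-below-p 1≤i)

  D-≺-D-suc : ∀ i → 1 ≤ i → D p i ≺ D p (suc i)
  D-≺-D-suc i 1≤i =
    ≺-at (p i) agree (D-at-p i) (divBy-R p (suc i) (p i) i ≤-refl ∣-refl) (even-below-p 1≤i)
    where
    agree : ∀ n → n < p i → D p i n ≡ D p (suc i) n
    agree n n<pi = trans (D-below-p 1≤i n n<pi)
                         (sym (D-below-p (m≤n⇒m≤1+n 1≤i) n (<-trans n<pi (p-step i))))

  D-≺-D∞ : ∀ i → 1 ≤ i → D p i ≺ D∞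
  D-≺-D∞ i 1≤i =
    ≺-at (p i) (D-below-p 1≤i) (D-at-p i) (D∞-beyond-1 (<⇒≤ (p>2 1≤i))) (even-below-p 1≤i)
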